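{- For all formulas $A,B$, each of the following sequents is provable both in $\mathbf{CNL_4^2}$ and in $\mathbf{CNLL_4^2}$ (where $X\dashv\vdash Y$ means that both $X\vdash Y$ and $Y\vdash X$ are provable): (De1) ${\sim}^{2}A\wedge{\sim}^{2}B\dashv\vdash{\sim}^{2}(A\vee B)$; (De2) ${\sim}^{2}A\vee{\sim}^{2}B\dashv\vdash{\sim}^{2}(A\wedge B)$; (T) $B\vdash A\vee{\sim}^{2}A$.
   Context: Formulas are built from a countable set $PV$ of propositional variables using binary connectives $\wedge,\vee$ and a unary connective ${\sim}$. Write ${\sim}^{2}A$ for ${\sim}{\sim}A$, ${\sim}^{4}A$ for ${\sim}{\sim}{\sim}{\sim}A$, etc. A sequent is an expression $A\vdash B$ with single formulas $A,B$. Both calculi share the axiom schemata (for arbitrary formulas $A,B,C$): (a1) $A\wedge B\vdash A$; (a2) $A\wedge B\vdash B$; (a3) $B\vdash A\vee B$; (a4) $A\vdash A\vee B$; (a5) $A\vdash{\sim}^{4}A$; (a6) ${\sim}^{4}A\vdash A$; (a7) ${\sim}A\wedge{\sim}B\vdash{\sim}(A\wedge B)$; (a8) ${\sim}(A\vee B)\vdash{\sim}A\vee{\sim}B$; (a9) $A\wedge{\sim}^{2}A\vdash B$; (a10) $A\wedge(B\vee C)\vdash(A\wedge B)\vee(A\wedge C)$; and the rules: (r1) from $A\vdash B$ and $B\vdash C$ infer $A\vdash C$; (r2) from $A\vdash B$ and $A\vdash C$ infer $A\vdash B\wedge C$; (r3) from $A\vdash C$ and $B\vdash C$ infer $A\vee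 B\vdash C$; (r4) from $A\vdash B$ infer ${\sim}^{2}B\vdash{\sim}^{2}A$. $\mathbf{CNL_4^2}$ adds the schemata (b1) ${\sim}(A\wedge B)\vdash{\sim}A\wedge{\sim}B$ and (b2) ${\sim}A\vee{\sim}B\vdash{\sim}(A\vee B)$. $\mathbf{CNLL_4^2}$ instead adds: (c1) ${\sim}A\wedge{\sim}B\vdash{\sim}(A\vee B)$; (c2) ${\sim}(A\wedge B)\vdash{\sim}A\vee{\sim}B$; (c3) ${\sim}A\wedge{\sim}^{2}A\vdash{\sim}(A\wedge B)$; (c4) $A\wedge{\sim}A\vdash{\sim}(A\vee B)$; (c5) ${\sim}(A\vee B)\vdash{\sim}A\vee B$; (c6) ${\sim}(A\vee B)\vdash{\sim}(B\vee A)$; (c7) ${\sim}(A\wedge B)\vdash{\sim}(B\wedge A)$; (c8) ${\sim}(A\vee B)\wedge{\sim}(A\wedge B)\vdash{\sim}A\wedge{\sim}B$. A proof in a calculus is a finite list of sequents each of which is an axiom of that calculus or follows from earlier ones by a rule; a sequent is provable if it is the last item of some proof. -}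

module Defs where

open import Data.Nat using (ℕ)
open import Data.Product using (_×_)

data Formula : Set where
  var  : ℕ → Formula
  _∧_  : Formula → Formula → Formula
  _∨_  : Formula → Formula → Formula
  ∼_   : Formula → Formula

infixr 6 _∧_
infixr 5 _∨_
infix  8 ∼_
infix  3 _⊢_

record Sequent : Set where
  constructor _⊢_
  field
    lhs : Formula
    rhs : Formula

∼² : Formula → Formula
∼² A = ∼ ∼ A

∼⁴ : Formula → Formula
∼⁴ A = ∼ ∼ ∼ ∼ A

data BaseAxiom : Sequent → Set where
  a1  : ∀ A B → BaseAxiom (A ∧ B ⊢ A)
  a2  : ∀ A B → BaseAxiom (A ∧ B ⊢ B)
  a3  : ∀ A B → BaseAxiom (B ⊢ A ∨ B)
  a4  : ∀ A B → BaseAxiom (A ⊢ A ∨ B)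
  a5  : ∀ A → BaseAxiom (A ⊢ ∼⁴ A)
  a6  : ∀ A → BaseAxiom (∼⁴ A ⊢ A)
  a7  : ∀ A B → BaseAxiom (∼ A ∧ ∼ B ⊢ ∼ (A ∧ B))
  a8  : ∀ A B → BaseAxiom (∼ (A ∨ B) ⊢ ∼ A ∨ ∼ B)
  a9  : ∀ A B → BaseAxiom (A ∧ ∼² A ⊢ B)
  a10 : ∀ A B C → BaseAxiom (A ∧ (B ∨ C) ⊢ (A ∧ B) ∨ (A ∧ C))

data CNLAxiom : Sequent → Set where
  b1 : ∀ A B → CNLAxiom (∼ (A ∧ B) ⊢ ∼ A ∧ ∼ B)
  b2 : ∀ A B → CNLAxiom (∼ A ∨ ∼ B ⊢ ∼ (A ∨ B))

data CNLLAxiom : Sequent → Set where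
  c1 : ∀ A B → CNLLAxiom (∼ A ∧ ∼ B ⊢ ∼ (A ∨ B))
  c2 : ∀ A B → CNLLAxiom (∼ (A ∧ B) ⊢ ∼ A ∨ ∼ B)
  c3 : ∀ A B → CNLLAxiom (∼ A ∧ ∼² A ⊢ ∼ (A ∧ B))
  c4 : ∀ A B → CNLLAxiom (A ∧ ∼ A ⊢ ∼ (A ∨ B))
  c5 : ∀ A B → CNLLAxiom (∼ (A ∨ B) ⊢ ∼ A ∨ B)
  c6 : ∀ A B → CNLLAxiom (∼ (A ∨ B) ⊢ ∼ (B ∨ A))
  c7 : ∀ A B → CNLLAxiom (∼ (A ∧ B) ⊢ ∼ (B ∧ A))
  c8 : ∀ A B → CNLLAxiom (∼ (A ∨ B) ∧ ∼ (A ∧ B) ⊢ ∼ A ∧ ∼ B)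

data Provable (Extra : Sequent → Set) : Sequent → Set where
  base  : ∀ {s} → BaseAxiom s → Provable Extra s
  extra : ∀ {s} → Extra s → Provable Extra s
  r1 : ∀ {A B C} → Provable Extra (A ⊢ B) → Provable Extra (B ⊢ C) → Provable Extra (A ⊢ C)
  r2 : ∀ {A B C} → Provable Extra (A ⊢ B) → Provable Extra (A ⊢ C) → Provable Extra (A ⊢ B ∧ C)
  r3 : ∀ {A B C} → Provable Extra (A ⊢ C) → Provable Extra (B ⊢ C) → Provable Extra (A ∨ B ⊢ C)
  r4 : ∀ {A B} → Provable Extra (A ⊢ B) → Provable Extra (∼² B ⊢ ∼² A)

CNL : Sequent → Set
CNL = Provable CNLAxiom

CNLL : Sequent → Set
CNLL = Provable CNLLAxiom

Interprovable : (Sequent → Set) → Formula → Formula → Set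
Interprovable P X Y = P (X ⊢ Y) × P (Y ⊢ X)

-- Everything follows from the base axioms (a1)–(a10) and rules (r1)–(r4) alone,
-- so it holds in every extension, in particular in CNL₄² and CNLL₄². Since ∼² is
-- antitone (r4) and an involution up to ∼⁴ ⊣⊢ id (a5, a6), it exchanges ∧ and ∨
-- as a classical negation would; and ∼² of an excluded middle A ∨ ∼² A entails
-- ∼² A ∧ ∼⁴ A, which is explosive by (a9), so A ∨ ∼² A follows from anything.
module Submission where

open import Defs
open import Data.Product using (_×_; _,_)

module _ {Extra : Sequent → Set} where

  private
    ⊢_ : Sequent → Set
    ⊢_ = Provable Extra

  infix 2 ⊢_

  ∼⁴-intro : ∀ A → ⊢ A ⊢ ∼⁴ A
  ∼⁴-intro A = base (a5 A)

  ∼⁴-elim : ∀ A → ⊢ ∼⁴ A ⊢ A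
  ∼⁴-elim A = base (a6 A)

  ∼²-swapʳ : ∀ {A B} → ⊢ A ⊢ ∼² B → ⊢ B ⊢ ∼² A
  ∼²-swapʳ p = r1 (∼⁴-intro _) (r4 p)

  ∼²-swapˡ : ∀ {A B} → ⊢ ∼² A ⊢ B → ⊢ ∼² B ⊢ A
  ∼²-swapˡ p = r1 (r4 p) (∼⁴-elim _)

  ∧-mono : ∀ {A B C D} → ⊢ A ⊢ C → ⊢ B ⊢ D → ⊢ A ∧ B ⊢ C ∧ D
  ∧-mono p q = r2 (r1 (base (a1 _ _)) p) (r1 (base (a2 _ _)) q)

  ∼²-∨⇒∧ : ∀ A B → ⊢ ∼² (A ∨ B) ⊢ ∼² A ∧ ∼² B
  ∼²-∨⇒∧ A B = r2 (r4 (base (a4 A B))) (r4 (base (a3 A B)))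

  ∧⇒∼²-∨ : ∀ A B → ⊢ ∼² A ∧ ∼² B ⊢ ∼² (A ∨ B)
  ∧⇒∼²-∨ A B = ∼²-swapʳ (r3 (∼²-swapʳ (base (a1 _ _))) (∼²-swapʳ (base (a2 _ _))))

  ∨⇒∼²-∧ : ∀ A B → ⊢ ∼² A ∨ ∼² B ⊢ ∼² (A ∧ B)
  ∨⇒∼²-∧ A B = r3 (r4 (base (a1 A B))) (r4 (base (a2 A B)))

  ∼²-∧⇒∨ : ∀ A B → ⊢ ∼² (A ∧ B) ⊢ ∼² A ∨ ∼² B
  ∼²-∧⇒∨ A B =
    ∼²-swapˡ (r1 (∼²-∨⇒∧ (∼² A) (∼² B)) (∧-mono (∼⁴-elim A) (∼⁴-elim B)))

  excluded-middle : ∀ A B → ⊢ B ⊢ A ∨ ∼² A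
  excluded-middle A B =
    r1 (∼⁴-intro B) (∼²-swapˡ (r1 (∼²-∨⇒∧ A (∼² A)) (base (a9 (∼² A) (∼² B)))))

DoubleNegationLaws : (Sequent → Set) → Formula → Formula → Set
DoubleNegationLaws P A B =
  Interprovable P (∼² A ∧ ∼² B) (∼² (A ∨ B))
  × Interprovable P (∼² A ∨ ∼² B) (∼² (A ∧ B))
  × P (B ⊢ A ∨ ∼² A)

double-negation-laws : ∀ {Extra} A B → DoubleNegationLaws (Provable Extra) A B
double-negation-laws A B =
  (∧⇒∼²-∨ A B , ∼²-∨⇒∧ A B) , (∨⇒∼²-∧ A B , ∼²-∧⇒∨ A B) , excluded-middle A B

mainTheorem2 : (A B : Formula) →
    (Interprovable CNL (∼² A ∧ ∼² B) (∼² (A ∨ B))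
      × Interprovable CNL (∼² A ∨ ∼² B) (∼² (A ∧ B))
      × CNL (B ⊢ A ∨ ∼² A))
    × (Interprovable CNLL (∼² A ∧ ∼² B) (∼² (A ∨ B))
      × Interprovable CNLL (∼² A ∨ ∼² B) (∼² (A ∧ B))
      × CNLL (B ⊢ A ∨ ∼² A))
mainTheorem2 A B = double-negation-laws A B , double-negation-laws A B
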